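{- For any Kleene algebra $\mathbb{K}$ and any heterogeneous Kleene algebra $\mathbb{H}$, $\mathbb{K}\cong(\mathbb{K}^+)_+$ and $\mathbb{H}\cong(\mathbb{H}_+)^+$. Moreover, these correspondences restrict to continuous Kleene algebras and continuous heterogeneous Kleene algebras.
   Context: A Kleene algebra is a structure $(K, \cup, \cdot, ()^\ast, 1, 0)$ such that: (K1) $(K,\cup,0)$ is a join-semilattice with bottom $0$; (K2) $(K,\cdot,1)$ is a monoid, $\cdot$ preserves $\cup$ in each coordinate, $0$ annihilates $\cdot$; (K3) $1\cup\alpha\cdot\alpha^\ast\leq\alpha^\ast$, $1\cup\alpha^\ast\cdot\alpha\leq\alpha^\ast$, $1\cup\alpha^\ast\cdot\alpha^\ast\leq\alpha^\ast$; (K4) $\alpha\cdot\beta\leq\beta$ implies $\alpha^\ast\cdot\beta\leq\beta$; (K5) $\beta\cdot\alpha\leq\beta$ implies $\beta\cdot\alpha^\ast\leq\beta$. It is continuous if moreover $(K,\cup,0)$ is a complete join-semilattice, $\cdot$ preserves arbitrary joins in each coordinate, and $\alpha^\ast=\bigcup_{n\geq 0}\alpha^n$ ($\alpha^0=1$, $\alpha^{n+1}=\alpha^n\cdot\alpha$). A heterogeneous Kleene algebra is a tuple $\mathbb{H}=(\mathbb{A},\mathbb{s},\otimes_1,\otimes_2,\gamma,e)$ such that: (H1) $\mathbb{A}=(A,\sqcup,\cdot,1,0)$ where $(A,\sqcup,0)$ is a join-semilattice with bottom $0$, $(A,\cdot,1)$ is a monoid, $\cdot$ preserves finite joins in each coordinate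 and $0$ annihilates $\cdot$; (H2) $\mathbb{s}=(S,\sqcup,0_s)$ is a join-semilattice with bottom $0_s$; (H3) $\otimes_1:S\times A\to A$ preserves finite joins in its second coordinate, is monotone in its first coordinate and has unit $1$ in its second coordinate, and $\otimes_2:A\times S\to A$ preserves finite joins in its first coordinate, is monotone in its second coordinate and has unit $1$ in its first coordinate; moreover $\xi\otimes_1\alpha=e(\xi)\cdot\alpha$ and $\alpha\otimes_2\xi=\alpha\cdot e(\xi)$; (H4) $\gamma:A\to S$ (surjective) and $e:S\to A$ (injective) satisfy $\gamma\dashv e$ and $\gamma(e(\xi))=\xi$ for all $\xi\in S$; (H5) $1\leq e(\xi)$ and $e(\xi)\cdot e(\xi)\leq e(\xi)$; (H6) $\alpha\cdot\beta\leq\beta$ implies $\gamma(\alpha)\otimes_1\beta\leq\beta$, and $\beta\cdot\alpha\leq\beta$ implies $\beta\otimes_2\gamma(\alpha)\leq\beta$. It is continuous if moreover $(A,\sqcup,0)$ is complete and $\cdot$ preserves arbitrary joins in each coordinate, $\mathbb{s}$ is a complete join-semilattice, and $e(\gamma(\alpha))=\bigcup_{n\in\mathbb{N}}\alpha^n$. For a Kleene algebra $\mathbb{K}$, $\mathbb{K}^+=(\mathbb{A},\mathbb{s},\otimes_1,\otimes_2,\gamma,e)$ is: $\mathbb{A}=(K,\cup,\cdot,1,0)$; $\mathbb{s}=(S,\sqcup,0_s)$ with $S=\mathsf{Range}(()^\ast)$, $\xi\sqcup\chi:=(\xi\cup\chi)^\ast$, $0_s:=0^\ast$; $\gamma(\alpha)=\alpha^\ast$,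 $e$ the inclusion $S\hookrightarrow K$; $\xi\otimes_1\alpha=\xi\cdot\alpha$, $\alpha\otimes_2\xi=\alpha\cdot\xi$. For a heterogeneous Kleene algebra $\mathbb{H}$, $\mathbb{H}_+=(A,\sqcup,\cdot,()^\ast,1,0)$ with $\alpha^\ast:=e(\gamma(\alpha))$. -}

module Defs where

open import Level using (Level; _⊔_; suc)
open import Data.Nat using (ℕ; zero) renaming (suc to sucℕ)
open import Data.Product using (Σ; ∃; _×_; _,_; proj₁; proj₂)
open import Relation.Binary.Structures using (IsEquivalence)
open import Relation.Binary.Core using (Rel)
open import Relation.Binary.PropositionalEquality using (_≡_)

IsLub : ∀ {c ℓ ι} {C : Set c} (_≤_ : Rel C ℓ) {I : Set ι} → (I → C) → C → Set (c ⊔ ℓ ⊔ ι)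
IsLub _≤_ {I} f s = (∀ i → f i ≤ s) × (∀ u → (∀ i → f i ≤ u) → s ≤ u)

record RawKA (c ℓ : Level) : Set (suc (c ⊔ ℓ)) where
  infix  4 _≈_ _≤_
  infixl 6 _∪_
  infixl 7 _·_
  field
    Carrier : Set c
    _≈_     : Rel Carrier ℓ
    isEquivalence : IsEquivalence _≈_
    _∪_ : Carrier → Carrier → Carrier
    _·_ : Carrier → Carrier → Carrier
    _⋆  : Carrier → Carrier
    1#  : Carrier
    0#  : Carrier

  _≤_ : Rel Carrier ℓ
  a ≤ b = (a ∪ b) ≈ b

  pow : Carrier → ℕ → Carrier
  pow a zero     = 1#
  pow a (sucℕ n) = pow a n · a

record IsKA {c ℓ} (K : RawKA c ℓ) : Set (c ⊔ ℓ) where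
  open RawKA K
  field
    ∪-cong : ∀ {a a′ b b′} → a ≈ a′ → b ≈ b′ → (a ∪ b) ≈ (a′ ∪ b′)
    ·-cong : ∀ {a a′ b b′} → a ≈ a′ → b ≈ b′ → (a · b) ≈ (a′ · b′)
    ⋆-cong : ∀ {a a′} → a ≈ a′ → (a ⋆) ≈ (a′ ⋆)
    ∪-assoc : ∀ a b c → ((a ∪ b) ∪ c) ≈ (a ∪ (b ∪ c))
    ∪-comm  : ∀ a b → (a ∪ b) ≈ (b ∪ a)
    ∪-idem  : ∀ a → (a ∪ a) ≈ a
    ∪-identityˡ : ∀ a → (0# ∪ a) ≈ a
    ·-assoc : ∀ a b c → ((a · b) · c) ≈ (a · (b · c))
    ·-identityˡ : ∀ a → (1# · a) ≈ a
    ·-identityʳ : ∀ a → (a · 1#) ≈ a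
    ·-distribˡ-∪ : ∀ a b c → (a · (b ∪ c)) ≈ ((a · b) ∪ (a · c))
    ·-distribʳ-∪ : ∀ a b c → ((b ∪ c) · a) ≈ ((b · a) ∪ (c · a))
    ·-zeroˡ : ∀ a → (0# · a) ≈ 0#
    ·-zeroʳ : ∀ a → (a · 0#) ≈ 0#
    ⋆-unfoldˡ : ∀ a → (1# ∪ a · (a ⋆)) ≤ (a ⋆)
    ⋆-unfoldʳ : ∀ a → (1# ∪ (a ⋆) · a) ≤ (a ⋆)
    ⋆-trans   : ∀ a → (1# ∪ (a ⋆) · (a ⋆)) ≤ (a ⋆)
    ⋆-indˡ : ∀ a b → (a · b) ≤ b → ((a ⋆) · b) ≤ b
    ⋆-indʳ : ∀ a b → (b · a) ≤ b → (b · (a ⋆)) ≤ b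

record IsContinuousKA {c ℓ} (ι : Level) (K : RawKA c ℓ) : Set (c ⊔ ℓ ⊔ suc ι) where
  open RawKA K
  field
    isKA : IsKA K
    complete : ∀ {I : Set ι} (f : I → Carrier) → Σ Carrier (IsLub _≤_ f)
    ·-preservesˡ-⋁ : ∀ {I : Set ι} (f : I → Carrier) s a →
                     IsLub _≤_ f s → IsLub _≤_ (λ i → a · f i) (a · s)
    ·-preservesʳ-⋁ : ∀ {I : Set ι} (f : I → Carrier) s a →
                     IsLub _≤_ f s → IsLub _≤_ (λ i → f i · a) (s · a)
    ⋆-⋁ : ∀ a → IsLub _≤_ (pow a) (a ⋆)

record RawHKA (a ℓa s ℓs : Level) : Set (suc (a ⊔ ℓa ⊔ s ⊔ ℓs)) where
  infix  4 _≈_ _≤_ _≈ₛ_ _≤ₛ_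
  infixl 6 _⊔A_ _⊔ₛ_
  infixl 7 _·_
  field
    A   : Set a
    _≈_ : Rel A ℓa
    isEquivalence : IsEquivalence _≈_
    _⊔A_ : A → A → A
    _·_  : A → A → A
    1#   : A
    0#   : A
    S    : Set s
    _≈ₛ_ : Rel S ℓs
    isEquivalenceₛ : IsEquivalence _≈ₛ_
    _⊔ₛ_ : S → S → S
    0ₛ   : S
    _⊗₁_ : S → A → A
    _⊗₂_ : A → S → A
    γ    : A → S
    e    : S → A

  _≤_ : Rel A ℓa
  x ≤ y = (x ⊔A y) ≈ y

  _≤ₛ_ : Rel S ℓs
  ξ ≤ₛ χ = (ξ ⊔ₛ χ) ≈ₛ χ

  pow : A → ℕ → A
  pow x zero     = 1#
  pow x (sucℕ n) = pow x n · x

record IsHKA {a ℓa s ℓs} (H : RawHKA a ℓa s ℓs) : Set (a ⊔ ℓa ⊔ s ⊔ ℓs) where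
  open RawHKA H
  field
    ⊔-cong : ∀ {x x′ y y′} → x ≈ x′ → y ≈ y′ → (x ⊔A y) ≈ (x′ ⊔A y′)
    ·-cong : ∀ {x x′ y y′} → x ≈ x′ → y ≈ y′ → (x · y) ≈ (x′ · y′)
    ⊔ₛ-cong : ∀ {ξ ξ′ χ χ′} → ξ ≈ₛ ξ′ → χ ≈ₛ χ′ → (ξ ⊔ₛ χ) ≈ₛ (ξ′ ⊔ₛ χ′)
    ⊗₁-cong : ∀ {ξ ξ′ x x′} → ξ ≈ₛ ξ′ → x ≈ x′ → (ξ ⊗₁ x) ≈ (ξ′ ⊗₁ x′)
    ⊗₂-cong : ∀ {x x′ ξ ξ′} → x ≈ x′ → ξ ≈ₛ ξ′ → (x ⊗₂ ξ) ≈ (x′ ⊗₂ ξ′)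
    γ-cong : ∀ {x x′} → x ≈ x′ → γ x ≈ₛ γ x′
    e-cong : ∀ {ξ ξ′} → ξ ≈ₛ ξ′ → e ξ ≈ e ξ′
    ⊔-assoc : ∀ x y z → ((x ⊔A y) ⊔A z) ≈ (x ⊔A (y ⊔A z))
    ⊔-comm  : ∀ x y → (x ⊔A y) ≈ (y ⊔A x)
    ⊔-idem  : ∀ x → (x ⊔A x) ≈ x
    ⊔-identityˡ : ∀ x → (0# ⊔A x) ≈ x
    ·-assoc : ∀ x y z → ((x · y) · z) ≈ (x · (y · z))
    ·-identityˡ : ∀ x → (1# · x) ≈ x
    ·-identityʳ : ∀ x → (x · 1#) ≈ x
    ·-distribˡ-⊔ : ∀ x y z → (x · (y ⊔A z)) ≈ ((x · y) ⊔A (x · z))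
    ·-distribʳ-⊔ : ∀ x y z → ((y ⊔A z) · x) ≈ ((y · x) ⊔A (z · x))
    ·-zeroˡ : ∀ x → (0# · x) ≈ 0#
    ·-zeroʳ : ∀ x → (x · 0#) ≈ 0#
    ⊔ₛ-assoc : ∀ ξ χ ζ → ((ξ ⊔ₛ χ) ⊔ₛ ζ) ≈ₛ (ξ ⊔ₛ (χ ⊔ₛ ζ))
    ⊔ₛ-comm  : ∀ ξ χ → (ξ ⊔ₛ χ) ≈ₛ (χ ⊔ₛ ξ)
    ⊔ₛ-idem  : ∀ ξ → (ξ ⊔ₛ ξ) ≈ₛ ξ
    ⊔ₛ-identityˡ : ∀ ξ → (0ₛ ⊔ₛ ξ) ≈ₛ ξ
    ⊗₁-distrib-⊔ : ∀ ξ x y → (ξ ⊗₁ (x ⊔A y)) ≈ ((ξ ⊗₁ x) ⊔A (ξ ⊗₁ y))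
    ⊗₁-zero      : ∀ ξ → (ξ ⊗₁ 0#) ≈ 0#
    ⊗₁-monoˡ     : ∀ {ξ χ} x → ξ ≤ₛ χ → (ξ ⊗₁ x) ≤ (χ ⊗₁ x)
    ⊗₁-unit      : ∀ ξ → (ξ ⊗₁ 1#) ≈ e ξ
    ⊗₂-distrib-⊔ : ∀ ξ x y → ((x ⊔A y) ⊗₂ ξ) ≈ ((x ⊗₂ ξ) ⊔A (y ⊗₂ ξ))
    ⊗₂-zero      : ∀ ξ → (0# ⊗₂ ξ) ≈ 0#
    ⊗₂-monoʳ     : ∀ {ξ χ} x → ξ ≤ₛ χ → (x ⊗₂ ξ) ≤ (x ⊗₂ χ)
    ⊗₂-unit      : ∀ ξ → (1# ⊗₂ ξ) ≈ e ξ
    ⊗₁-def       : ∀ ξ x → (ξ ⊗₁ x) ≈ (e ξ · x)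
    ⊗₂-def       : ∀ ξ x → (x ⊗₂ ξ) ≈ (x · e ξ)
    γ-surjective : ∀ ξ → ∃ λ x → γ x ≈ₛ ξ
    e-injective  : ∀ {ξ χ} → e ξ ≈ e χ → ξ ≈ₛ χ
    adjunction⇒  : ∀ x ξ → γ x ≤ₛ ξ → x ≤ e ξ
    adjunction⇐  : ∀ x ξ → x ≤ e ξ → γ x ≤ₛ ξ
    γ∘e          : ∀ ξ → γ (e ξ) ≈ₛ ξ
    e-reflexive  : ∀ ξ → 1# ≤ e ξ
    e-transitive : ∀ ξ → (e ξ · e ξ) ≤ e ξ
    γ-indˡ : ∀ x y → (x · y) ≤ y → (γ x ⊗₁ y) ≤ y
    γ-indʳ : ∀ x y → (y · x) ≤ y → (y ⊗₂ γ x) ≤ y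

record IsContinuousHKA {a ℓa s ℓs} (ι : Level) (H : RawHKA a ℓa s ℓs)
       : Set (a ⊔ ℓa ⊔ s ⊔ ℓs ⊔ suc ι) where
  open RawHKA H
  field
    isHKA : IsHKA H
    completeA : ∀ {I : Set ι} (f : I → A) → Σ A (IsLub _≤_ f)
    ·-preservesˡ-⋁ : ∀ {I : Set ι} (f : I → A) t x →
                     IsLub _≤_ f t → IsLub _≤_ (λ i → x · f i) (x · t)
    ·-preservesʳ-⋁ : ∀ {I : Set ι} (f : I → A) t x →
                     IsLub _≤_ f t → IsLub _≤_ (λ i → f i · x) (t · x)
    completeS : ∀ {I : Set ι} (f : I → S) → Σ S (IsLub _≤ₛ_ f)
    e∘γ-⋁ : ∀ x → IsLub _≤_ (pow x) (e (γ x))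

module _ {c ℓ : Level} (K : RawKA c ℓ) where
  open RawKA K

  -- S = Range(()⋆), as a subset of K with the inherited equality
  Range⋆ : Set (c ⊔ ℓ)
  Range⋆ = Σ Carrier λ x → ∃ λ y → (y ⋆) ≈ x

  _⁺ : RawHKA c ℓ (c ⊔ ℓ) ℓ
  _⁺ = record
    { A = Carrier
    ; _≈_ = _≈_
    ; isEquivalence = isEquivalence
    ; _⊔A_ = _∪_
    ; _·_ = _·_
    ; 1# = 1#
    ; 0# = 0#
    ; S = Range⋆
    ; _≈ₛ_ = λ ξ χ → proj₁ ξ ≈ proj₁ χ
    ; isEquivalenceₛ = record
        { refl = IsEquivalence.refl isEquivalence
        ; sym = IsEquivalence.sym isEquivalence
        ; trans = IsEquivalence.trans isEquivalence }
    ; _⊔ₛ_ = λ ξ χ → (((proj₁ ξ ∪ proj₁ χ) ⋆) , ((proj₁ ξ ∪ proj₁ χ) , IsEquivalence.refl isEquivalence))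
    ; 0ₛ = (0# ⋆) , (0# , IsEquivalence.refl isEquivalence)
    ; _⊗₁_ = λ ξ x → proj₁ ξ · x
    ; _⊗₂_ = λ x ξ → x · proj₁ ξ
    ; γ = λ x → (x ⋆) , (x , IsEquivalence.refl isEquivalence)
    ; e = proj₁
    }

module _ {a ℓa s ℓs : Level} (H : RawHKA a ℓa s ℓs) where
  open RawHKA H

  _₊ : RawKA a ℓa
  _₊ = record
    { Carrier = A
    ; _≈_ = _≈_
    ; isEquivalence = isEquivalence
    ; _∪_ = _⊔A_
    ; _·_ = _·_
    ; _⋆ = λ x → e (γ x)
    ; 1# = 1#
    ; 0# = 0#
    }

record KAIso {c ℓ c′ ℓ′} (K : RawKA c ℓ) (L : RawKA c′ ℓ′) : Set (c ⊔ ℓ ⊔ c′ ⊔ ℓ′) where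
  private
    module K = RawKA K
    module L = RawKA L
  field
    to   : K.Carrier → L.Carrier
    from : L.Carrier → K.Carrier
    to-cong   : ∀ {x y} → x K.≈ y → to x L.≈ to y
    from-cong : ∀ {x y} → x L.≈ y → from x K.≈ from y
    from∘to : ∀ x → from (to x) K.≈ x
    to∘from : ∀ y → to (from y) L.≈ y
    to-∪ : ∀ x y → to (x K.∪ y) L.≈ (to x L.∪ to y)
    to-· : ∀ x y → to (x K.· y) L.≈ (to x L.· to y)
    to-⋆ : ∀ x → to (x K.⋆) L.≈ (to x L.⋆)
    to-1 : to K.1# L.≈ L.1#
    to-0 : to K.0# L.≈ L.0#

record HKAIso {a ℓa s ℓs a′ ℓa′ s′ ℓs′}
              (H : RawHKA a ℓa s ℓs) (G : RawHKA a′ ℓa′ s′ ℓs′)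
              : Set (a ⊔ ℓa ⊔ s ⊔ ℓs ⊔ a′ ⊔ ℓa′ ⊔ s′ ⊔ ℓs′) where
  private
    module H = RawHKA H
    module G = RawHKA G
  field
    toA   : H.A → G.A
    fromA : G.A → H.A
    toA-cong   : ∀ {x y} → x H.≈ y → toA x G.≈ toA y
    fromA-cong : ∀ {x y} → x G.≈ y → fromA x H.≈ fromA y
    fromA∘toA : ∀ x → fromA (toA x) H.≈ x
    toA∘fromA : ∀ y → toA (fromA y) G.≈ y
    toS   : H.S → G.S
    fromS : G.S → H.S
    toS-cong   : ∀ {ξ χ} → ξ H.≈ₛ χ → toS ξ G.≈ₛ toS χ
    fromS-cong : ∀ {ξ χ} → ξ G.≈ₛ χ → fromS ξ H.≈ₛ fromS χ
    fromS∘toS : ∀ ξ → fromS (toS ξ) H.≈ₛ ξ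
    toS∘fromS : ∀ ξ → toS (fromS ξ) G.≈ₛ ξ
    toA-⊔ : ∀ x y → toA (x H.⊔A y) G.≈ (toA x G.⊔A toA y)
    toA-· : ∀ x y → toA (x H.· y) G.≈ (toA x G.· toA y)
    toA-1 : toA H.1# G.≈ G.1#
    toA-0 : toA H.0# G.≈ G.0#
    toS-⊔ : ∀ ξ χ → toS (ξ H.⊔ₛ χ) G.≈ₛ (toS ξ G.⊔ₛ toS χ)
    toS-0 : toS H.0ₛ G.≈ₛ G.0ₛ
    to-⊗₁ : ∀ ξ x → toA (ξ H.⊗₁ x) G.≈ (toS ξ G.⊗₁ toA x)
    to-⊗₂ : ∀ x ξ → toA (x H.⊗₂ ξ) G.≈ (toA x G.⊗₂ toS ξ)
    to-γ  : ∀ x → toS (H.γ x) G.≈ₛ G.γ (toA x)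
    to-e  : ∀ ξ → toA (H.e ξ) G.≈ G.e (toS ξ)

module Submission where

-- Both round trips are the identity on the algebra part, so everything rests on two facts.
-- In a Kleene algebra ⋆ is a closure operator whose fixed points are Range(⋆), hence
-- x ≤ χ ⟺ x⋆ ≤ χ for star elements χ: this makes (ξ ∪ χ)⋆ their join and ⋆ left adjoint
-- to the inclusion. In a heterogeneous Kleene algebra γ, as a left adjoint, preserves
-- joins, and e∘γ inherits the star laws from (H5) and (H6).

open import Defs
open import Level using (Level)
open import Data.Product using (_×_; _,_; proj₁; ∃)
open import Data.Nat using (zero) renaming (suc to sucℕ)
open import Relation.Binary.Core using (Rel)
open import Relation.Binary.Bundles using (Poset)
open import Relation.Binary.Structures using (IsEquivalence)
open import Relation.Binary.PropositionalEquality as ≡ using (_≗_)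
import Relation.Binary.Reasoning.PartialOrder as PosetReasoning

IsLub-resp-≗ : ∀ {c ℓ ι} {C : Set c} (_≤_ : Rel C ℓ) {I : Set ι} {f g : I → C} {s : C} →
               f ≗ g → IsLub _≤_ f s → IsLub _≤_ g s
IsLub-resp-≗ _≤_ {s = s} f≗g (upper , least) =
  (λ i → ≡.subst (_≤ s) (f≗g i) (upper i)) ,
  (λ u g≤u → least u (λ i → ≡.subst (_≤ u) (≡.sym (f≗g i)) (g≤u i)))

module JoinNaturalOrder
  {c ℓ} {C : Set c} (_≈_ : Rel C ℓ) (isEquivalence : IsEquivalence _≈_) (_∨_ : C → C → C)
  (∨-cong : ∀ {x x′ y y′} → x ≈ x′ → y ≈ y′ → (x ∨ y) ≈ (x′ ∨ y′))
  (∨-assoc : ∀ x y z → ((x ∨ y) ∨ z) ≈ (x ∨ (y ∨ z)))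
  (∨-comm : ∀ x y → (x ∨ y) ≈ (y ∨ x))
  (∨-idem : ∀ x → (x ∨ x) ≈ x) where

  open IsEquivalence isEquivalence renaming (refl to ≈-refl; sym to ≈-sym; trans to ≈-trans)

  _≤_ : Rel C ℓ
  x ≤ y = (x ∨ y) ≈ y

  ≤-reflexive : ∀ {x y} → x ≈ y → x ≤ y
  ≤-reflexive x≈y = ≈-trans (∨-cong x≈y ≈-refl) (∨-idem _)

  ≤-trans : ∀ {x y z} → x ≤ y → y ≤ z → x ≤ z
  ≤-trans {x} {y} {z} x≤y y≤z =
    ≈-trans (∨-cong ≈-refl (≈-sym y≤z))
      (≈-trans (≈-sym (∨-assoc x y z)) (≈-trans (∨-cong x≤y ≈-refl) y≤z))

  ≤-antisym : ∀ {x y} → x ≤ y → y ≤ x → x ≈ y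
  ≤-antisym {x} {y} x≤y y≤x = ≈-trans (≈-sym y≤x) (≈-trans (∨-comm y x) x≤y)

  poset : Poset c ℓ ℓ
  poset = record
    { isPartialOrder = record
      { isPreorder = record
        { isEquivalence = isEquivalence ; reflexive = ≤-reflexive ; trans = ≤-trans }
      ; antisym = ≤-antisym } }

  x≤x∨y : ∀ x y → x ≤ (x ∨ y)
  x≤x∨y x y = ≈-trans (≈-sym (∨-assoc x x y)) (∨-cong (∨-idem x) ≈-refl)

  y≤x∨y : ∀ x y → y ≤ (x ∨ y)
  y≤x∨y x y = ≤-trans (x≤x∨y y x) (≤-reflexive (∨-comm y x))

  ∨-least : ∀ {x y z} → x ≤ z → y ≤ z → (x ∨ y) ≤ z
  ∨-least {x} {y} {z} x≤z y≤z = ≈-trans (∨-assoc x y z) (≈-trans (∨-cong ≈-refl y≤z) x≤z)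

  ∨-homomorphism⇒monotone : (f : C → C) → (∀ {x y} → x ≈ y → f x ≈ f y) →
                            (∀ x y → f (x ∨ y) ≈ (f x ∨ f y)) →
                            ∀ {x y} → x ≤ y → f x ≤ f y
  ∨-homomorphism⇒monotone f f-cong f-∨ x≤y = ≈-trans (≈-sym (f-∨ _ _)) (f-cong x≤y)

module KleeneAlgebraProperties {c ℓ} (K : RawKA c ℓ) (isKA : IsKA K) where
  open RawKA K
  open IsKA isKA
  open IsEquivalence isEquivalence using () renaming (refl to ≈-refl; trans to ≈-trans)
  open JoinNaturalOrder _≈_ isEquivalence _∪_ ∪-cong ∪-assoc ∪-comm ∪-idem hiding (_≤_)
  open PosetReasoning poset

  ·-monoˡ : ∀ {x y} z → x ≤ y → (x · z) ≤ (y · z)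
  ·-monoˡ z = ∨-homomorphism⇒monotone (_· z) (λ p → ·-cong p ≈-refl) (·-distribʳ-∪ z)

  ·-monoʳ : ∀ {x y} z → x ≤ y → (z · x) ≤ (z · y)
  ·-monoʳ z = ∨-homomorphism⇒monotone (z ·_) (·-cong ≈-refl) (·-distribˡ-∪ z)

  0#≤ : ∀ x → 0# ≤ x
  0#≤ = ∪-identityˡ

  1#≤⋆ : ∀ x → 1# ≤ (x ⋆)
  1#≤⋆ x = ≤-trans (x≤x∨y 1# _) (⋆-unfoldˡ x)

  ⋆·⋆≤⋆ : ∀ x → ((x ⋆) · (x ⋆)) ≤ (x ⋆)
  ⋆·⋆≤⋆ x = ≤-trans (y≤x∨y 1# _) (⋆-trans x)

  x≤x⋆ : ∀ x → x ≤ (x ⋆)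
  x≤x⋆ x = begin
    x             ≈⟨ ·-identityʳ x ⟨
    x · 1#        ≤⟨ ·-monoʳ x (1#≤⋆ x) ⟩
    x · (x ⋆)     ≤⟨ ≤-trans (y≤x∨y 1# _) (⋆-unfoldˡ x) ⟩
    x ⋆           ∎

  ⋆-mono : ∀ {x y} → x ≤ y → (x ⋆) ≤ (y ⋆)
  ⋆-mono {x} {y} x≤y = begin
    x ⋆              ≈⟨ ·-identityʳ (x ⋆) ⟨
    (x ⋆) · 1#       ≤⟨ ·-monoʳ (x ⋆) (1#≤⋆ y) ⟩
    (x ⋆) · (y ⋆)    ≤⟨ ⋆-indˡ x (y ⋆) x·y⋆≤y⋆ ⟩
    y ⋆              ∎
    where
    x·y⋆≤y⋆ : (x · (y ⋆)) ≤ (y ⋆)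
    x·y⋆≤y⋆ = begin
      x · (y ⋆)        ≤⟨ ·-monoˡ (y ⋆) (≤-trans x≤y (x≤x⋆ y)) ⟩
      (y ⋆) · (y ⋆)    ≤⟨ ⋆·⋆≤⋆ y ⟩
      y ⋆              ∎

  ⋆-idem : ∀ x → ((x ⋆) ⋆) ≈ (x ⋆)
  ⋆-idem x = ≤-antisym ⋆⋆≤⋆ (x≤x⋆ (x ⋆))
    where
    ⋆⋆≤⋆ : ((x ⋆) ⋆) ≤ (x ⋆)
    ⋆⋆≤⋆ = begin
      (x ⋆) ⋆           ≈⟨ ·-identityˡ ((x ⋆) ⋆) ⟨
      1# · ((x ⋆) ⋆)    ≤⟨ ·-monoˡ ((x ⋆) ⋆) (1#≤⋆ x) ⟩
      (x ⋆) · ((x ⋆) ⋆) ≤⟨ ⋆-indʳ (x ⋆) (x ⋆) (⋆·⋆≤⋆ x) ⟩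
      x ⋆               ∎

  IsStar : Carrier → Set (c Level.⊔ ℓ)
  IsStar x = ∃ λ y → (y ⋆) ≈ x

  star-⋆-fixed : ∀ {x} → IsStar x → (x ⋆) ≈ x
  star-⋆-fixed {x} (y , y⋆≈x) = begin-equality
    x ⋆         ≈⟨ ⋆-cong y⋆≈x ⟨
    (y ⋆) ⋆     ≈⟨ ⋆-idem y ⟩
    y ⋆         ≈⟨ y⋆≈x ⟩
    x           ∎

  ⋆-least : ∀ {x χ} → IsStar χ → x ≤ χ → (x ⋆) ≤ χ
  ⋆-least {x} {χ} χ-star x≤χ = begin
    x ⋆     ≤⟨ ⋆-mono x≤χ ⟩
    χ ⋆     ≈⟨ star-⋆-fixed χ-star ⟩
    χ       ∎

  star-reflexive : ∀ {χ} → IsStar χ → 1# ≤ χ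
  star-reflexive (y , y⋆≈χ) = ≤-trans (1#≤⋆ y) (≤-reflexive y⋆≈χ)

  star-transitive : ∀ {χ} → IsStar χ → (χ · χ) ≤ χ
  star-transitive {χ} (y , y⋆≈χ) = begin
    χ · χ           ≈⟨ ·-cong y⋆≈χ y⋆≈χ ⟨
    (y ⋆) · (y ⋆)   ≤⟨ ⋆·⋆≤⋆ y ⟩
    y ⋆             ≈⟨ y⋆≈χ ⟩
    χ               ∎

  ⋆-absorbˡ : ∀ x y → (((x ⋆) ∪ y) ⋆) ≈ ((x ∪ y) ⋆)
  ⋆-absorbˡ x y = ≤-antisym
    (⋆-least (_ , ≈-refl) (∨-least (⋆-mono (x≤x∨y x y)) (≤-trans (y≤x∨y x y) (x≤x⋆ _))))
    (⋆-mono (∨-least (≤-trans (x≤x⋆ x) (x≤x∨y _ y)) (y≤x∨y _ y)))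

  ⋆-absorbʳ : ∀ x y → ((x ∪ (y ⋆)) ⋆) ≈ ((x ∪ y) ⋆)
  ⋆-absorbʳ x y = begin-equality
    (x ∪ (y ⋆)) ⋆   ≈⟨ ⋆-cong (∪-comm x (y ⋆)) ⟩
    ((y ⋆) ∪ x) ⋆   ≈⟨ ⋆-absorbˡ y x ⟩
    (y ∪ x) ⋆       ≈⟨ ⋆-cong (∪-comm y x) ⟩
    (x ∪ y) ⋆       ∎

  ≤ₛ⇒≤ : ∀ {x χ} → ((x ∪ χ) ⋆) ≈ χ → x ≤ χ
  ≤ₛ⇒≤ {x} {χ} eq = begin
    x              ≤⟨ x≤x∨y x χ ⟩
    x ∪ χ          ≤⟨ x≤x⋆ (x ∪ χ) ⟩
    (x ∪ χ) ⋆      ≈⟨ eq ⟩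
    χ              ∎

  ≤⇒≤ₛ : ∀ {x χ} → IsStar χ → x ≤ χ → ((x ∪ χ) ⋆) ≈ χ
  ≤⇒≤ₛ χ-star x≤χ =
    ≤-antisym (⋆-least χ-star (∨-least x≤χ (≤-reflexive ≈-refl))) (≤-trans (y≤x∨y _ _) (x≤x⋆ _))

  ⁺-isHKA : IsHKA (K ⁺)
  ⁺-isHKA = record
    { ⊔-cong = ∪-cong ; ·-cong = ·-cong
    ; ⊔ₛ-cong = λ p q → ⋆-cong (∪-cong p q)
    ; ⊗₁-cong = ·-cong ; ⊗₂-cong = ·-cong
    ; γ-cong = ⋆-cong ; e-cong = λ p → p
    ; ⊔-assoc = ∪-assoc ; ⊔-comm = ∪-comm ; ⊔-idem = ∪-idem ; ⊔-identityˡ = ∪-identityˡ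
    ; ·-assoc = ·-assoc ; ·-identityˡ = ·-identityˡ ; ·-identityʳ = ·-identityʳ
    ; ·-distribˡ-⊔ = ·-distribˡ-∪ ; ·-distribʳ-⊔ = ·-distribʳ-∪
    ; ·-zeroˡ = ·-zeroˡ ; ·-zeroʳ = ·-zeroʳ
    ; ⊔ₛ-assoc = λ ξ χ ζ → ⊔ₛ-assoc (proj₁ ξ) (proj₁ χ) (proj₁ ζ)
    ; ⊔ₛ-comm = λ ξ χ → ⋆-cong (∪-comm _ _)
    ; ⊔ₛ-idem = λ { (χ , χ-star) → ≈-trans (⋆-cong (∪-idem χ)) (star-⋆-fixed χ-star) }
    ; ⊔ₛ-identityˡ = λ { (χ , χ-star) → ≤⇒≤ₛ χ-star (⋆-least χ-star (0#≤ χ)) }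
    ; ⊗₁-distrib-⊔ = λ ξ → ·-distribˡ-∪ (proj₁ ξ)
    ; ⊗₁-zero = λ ξ → ·-zeroʳ (proj₁ ξ)
    ; ⊗₁-monoˡ = λ x ξ≤ₛχ → ·-monoˡ x (≤ₛ⇒≤ ξ≤ₛχ)
    ; ⊗₁-unit = λ ξ → ·-identityʳ (proj₁ ξ)
    ; ⊗₂-distrib-⊔ = λ ξ → ·-distribʳ-∪ (proj₁ ξ)
    ; ⊗₂-zero = λ ξ → ·-zeroˡ (proj₁ ξ)
    ; ⊗₂-monoʳ = λ x ξ≤ₛχ → ·-monoʳ x (≤ₛ⇒≤ ξ≤ₛχ)
    ; ⊗₂-unit = λ ξ → ·-identityˡ (proj₁ ξ)
    ; ⊗₁-def = λ ξ x → ≈-refl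
    ; ⊗₂-def = λ ξ x → ≈-refl
    ; γ-surjective = λ { (χ , χ-star) → χ-star }
    ; e-injective = λ p → p
    ; adjunction⇒ = λ { x (χ , χ-star) x⋆≤ₛχ → ≤-trans (x≤x⋆ x) (≤ₛ⇒≤ x⋆≤ₛχ) }
    ; adjunction⇐ = λ { x (χ , χ-star) x≤χ → ≤⇒≤ₛ χ-star (⋆-least χ-star x≤χ) }
    ; γ∘e = λ { (χ , χ-star) → star-⋆-fixed χ-star }
    ; e-reflexive = λ { (χ , χ-star) → star-reflexive χ-star }
    ; e-transitive = λ { (χ , χ-star) → star-transitive χ-star }
    ; γ-indˡ = ⋆-indˡ
    ; γ-indʳ = ⋆-indʳ
    }
    where
    ⊔ₛ-assoc : ∀ x y z → ((((x ∪ y) ⋆) ∪ z) ⋆) ≈ ((x ∪ ((y ∪ z) ⋆)) ⋆)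
    ⊔ₛ-assoc x y z = begin-equality
      (((x ∪ y) ⋆) ∪ z) ⋆    ≈⟨ ⋆-absorbˡ (x ∪ y) z ⟩
      ((x ∪ y) ∪ z) ⋆        ≈⟨ ⋆-cong (∪-assoc x y z) ⟩
      (x ∪ (y ∪ z)) ⋆        ≈⟨ ⋆-absorbʳ x (y ∪ z) ⟨
      (x ∪ ((y ∪ z) ⋆)) ⋆    ∎

  ⁺₊-iso : KAIso K ((K ⁺) ₊)
  ⁺₊-iso = record
    { to = λ x → x ; from = λ x → x
    ; to-cong = λ p → p ; from-cong = λ p → p
    ; from∘to = λ x → ≈-refl ; to∘from = λ x → ≈-refl
    ; to-∪ = λ x y → ≈-refl ; to-· = λ x y → ≈-refl ; to-⋆ = λ x → ≈-refl
    ; to-1 = ≈-refl ; to-0 = ≈-refl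
    }

  pow-⁺ : ∀ x → pow x ≗ RawHKA.pow (K ⁺) x
  pow-⁺ x zero     = ≡.refl
  pow-⁺ x (sucℕ n) = ≡.cong (_· x) (pow-⁺ x n)

module ContinuousKleeneAlgebraProperties {c ℓ ι} (K : RawKA c ℓ) (cK : IsContinuousKA ι K) where
  open RawKA K
  open IsContinuousKA cK
  open IsKA isKA
  open IsEquivalence isEquivalence using () renaming (refl to ≈-refl)
  open JoinNaturalOrder _≈_ isEquivalence _∪_ ∪-cong ∪-assoc ∪-comm ∪-idem using (≤-trans)
  open KleeneAlgebraProperties K isKA

  Range⋆-complete : ∀ {I : Set ι} (f : I → Range⋆ K) →
                    ∃ (IsLub (RawHKA._≤ₛ_ (K ⁺)) f)
  Range⋆-complete f with complete (λ i → proj₁ (f i))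
  ... | s , (upper , least) =
    ((s ⋆) , (s , ≈-refl)) ,
    (λ i → ≤⇒≤ₛ (s , ≈-refl) (≤-trans (upper i) (x≤x⋆ s))) ,
    (λ { (χ , χ-star) f≤ₛχ → ≤⇒≤ₛ χ-star (⋆-least χ-star (least χ (λ i → ≤ₛ⇒≤ (f≤ₛχ i)))) })

  ⁺-isContinuousHKA : IsContinuousHKA ι (K ⁺)
  ⁺-isContinuousHKA = record
    { isHKA = ⁺-isHKA
    ; completeA = complete
    ; ·-preservesˡ-⋁ = ·-preservesˡ-⋁
    ; ·-preservesʳ-⋁ = ·-preservesʳ-⋁
    ; completeS = Range⋆-complete
    ; e∘γ-⋁ = λ x → IsLub-resp-≗ _≤_ (pow-⁺ x) (⋆-⋁ x)
    }

module HeterogeneousKleeneAlgebraProperties {a ℓa s ℓs} (H : RawHKA a ℓa s ℓs) (isH : IsHKA H) where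
  open RawHKA H
  open IsHKA isH
  open IsEquivalence isEquivalence using () renaming (refl to ≈-refl; sym to ≈-sym)
  open IsEquivalence isEquivalenceₛ using () renaming (sym to ≈ₛ-sym; trans to ≈ₛ-trans)
  module 𝔸 = JoinNaturalOrder _≈_ isEquivalence _⊔A_ ⊔-cong ⊔-assoc ⊔-comm ⊔-idem
  module 𝕤 = JoinNaturalOrder _≈ₛ_ isEquivalenceₛ _⊔ₛ_ ⊔ₛ-cong ⊔ₛ-assoc ⊔ₛ-comm ⊔ₛ-idem

  ·-monoˡ : ∀ {x y} z → x ≤ y → (x · z) ≤ (y · z)
  ·-monoˡ z = 𝔸.∨-homomorphism⇒monotone (_· z) (λ p → ·-cong p ≈-refl) (·-distribʳ-⊔ z)

  ·-monoʳ : ∀ {x y} z → x ≤ y → (z · x) ≤ (z · y)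
  ·-monoʳ z = 𝔸.∨-homomorphism⇒monotone (z ·_) (·-cong ≈-refl) (·-distribˡ-⊔ z)

  x≤e∘γ : ∀ x → x ≤ e (γ x)
  x≤e∘γ x = adjunction⇒ x (γ x) (⊔ₛ-idem (γ x))

  γ-mono : ∀ {x y} → x ≤ y → γ x ≤ₛ γ y
  γ-mono {x} {y} x≤y = adjunction⇐ x (γ y) (𝔸.≤-trans x≤y (x≤e∘γ y))

  γ-⊔ : ∀ x y → γ (x ⊔A y) ≈ₛ (γ x ⊔ₛ γ y)
  γ-⊔ x y = 𝕤.≤-antisym
    (adjunction⇐ _ _ (𝔸.∨-least (adjunction⇒ x _ (𝕤.x≤x∨y _ _)) (adjunction⇒ y _ (𝕤.y≤x∨y _ _))))
    (𝕤.∨-least (γ-mono (𝔸.x≤x∨y x y)) (γ-mono (𝔸.y≤x∨y x y)))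

  γ-0 : γ 0# ≈ₛ 0ₛ
  γ-0 = 𝕤.≤-antisym (adjunction⇐ 0# 0ₛ (⊔-identityˡ (e 0ₛ))) (⊔ₛ-identityˡ (γ 0#))

  e∘γ-fixes-image : ∀ {x z} → e (γ z) ≈ x → e (γ x) ≈ x
  e∘γ-fixes-image {x} {z} e∘γz≈x = begin-equality
    e (γ x)            ≈⟨ e-cong (γ-cong e∘γz≈x) ⟨
    e (γ (e (γ z)))    ≈⟨ e-cong (γ∘e (γ z)) ⟩
    e (γ z)            ≈⟨ e∘γz≈x ⟩
    x                  ∎
    where open PosetReasoning 𝔸.poset

  ₊-isKA : IsKA (H ₊)
  ₊-isKA = record
    { ∪-cong = ⊔-cong ; ·-cong = ·-cong
    ; ⋆-cong = λ p → e-cong (γ-cong p)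
    ; ∪-assoc = ⊔-assoc ; ∪-comm = ⊔-comm ; ∪-idem = ⊔-idem ; ∪-identityˡ = ⊔-identityˡ
    ; ·-assoc = ·-assoc ; ·-identityˡ = ·-identityˡ ; ·-identityʳ = ·-identityʳ
    ; ·-distribˡ-∪ = ·-distribˡ-⊔ ; ·-distribʳ-∪ = ·-distribʳ-⊔
    ; ·-zeroˡ = ·-zeroˡ ; ·-zeroʳ = ·-zeroʳ
    ; ⋆-unfoldˡ = λ x → 𝔸.∨-least (e-reflexive _)
        (𝔸.≤-trans (·-monoˡ (e (γ x)) (x≤e∘γ x)) (e-transitive _))
    ; ⋆-unfoldʳ = λ x → 𝔸.∨-least (e-reflexive _)
        (𝔸.≤-trans (·-monoʳ (e (γ x)) (x≤e∘γ x)) (e-transitive _))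
    ; ⋆-trans = λ x → 𝔸.∨-least (e-reflexive _) (e-transitive _)
    ; ⋆-indˡ = λ x y x·y≤y → 𝔸.≤-trans (𝔸.≤-reflexive (≈-sym (⊗₁-def (γ x) y))) (γ-indˡ x y x·y≤y)
    ; ⋆-indʳ = λ x y y·x≤y → 𝔸.≤-trans (𝔸.≤-reflexive (≈-sym (⊗₂-def (γ x) y))) (γ-indʳ x y y·x≤y)
    }

  ₊⁺-iso : HKAIso H ((H ₊) ⁺)
  ₊⁺-iso = record
    { toA = λ x → x ; fromA = λ x → x
    ; toA-cong = λ p → p ; fromA-cong = λ p → p
    ; fromA∘toA = λ x → ≈-refl ; toA∘fromA = λ x → ≈-refl
    ; toS = λ ξ → e ξ , (e ξ , e-cong (γ∘e ξ))
    ; fromS = λ χ → γ (proj₁ χ)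
    ; toS-cong = e-cong
    ; fromS-cong = γ-cong
    ; fromS∘toS = γ∘e
    ; toS∘fromS = λ { (χ , (z , e∘γz≈χ)) → e∘γ-fixes-image e∘γz≈χ }
    ; toA-⊔ = λ x y → ≈-refl ; toA-· = λ x y → ≈-refl
    ; toA-1 = ≈-refl ; toA-0 = ≈-refl
    ; toS-⊔ = λ ξ χ → e-cong (≈ₛ-sym (≈ₛ-trans (γ-⊔ (e ξ) (e χ)) (⊔ₛ-cong (γ∘e ξ) (γ∘e χ))))
    ; toS-0 = e-cong (≈ₛ-sym γ-0)
    ; to-⊗₁ = ⊗₁-def
    ; to-⊗₂ = λ x ξ → ⊗₂-def ξ x
    ; to-γ = λ x → ≈-refl
    ; to-e = λ ξ → ≈-refl
    }

  pow-₊ : ∀ x → pow x ≗ RawKA.pow (H ₊) x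
  pow-₊ x zero     = ≡.refl
  pow-₊ x (sucℕ n) = ≡.cong (_· x) (pow-₊ x n)

module ContinuousHeterogeneousKleeneAlgebraProperties
  {a ℓa s ℓs ι} (H : RawHKA a ℓa s ℓs) (cH : IsContinuousHKA ι H) where
  open RawHKA H
  open IsContinuousHKA cH
  open HeterogeneousKleeneAlgebraProperties H isHKA using (₊-isKA; pow-₊)

  ₊-isContinuousKA : IsContinuousKA ι (H ₊)
  ₊-isContinuousKA = record
    { isKA = ₊-isKA
    ; complete = completeA
    ; ·-preservesˡ-⋁ = ·-preservesˡ-⋁
    ; ·-preservesʳ-⋁ = ·-preservesʳ-⋁
    ; ⋆-⋁ = λ x → IsLub-resp-≗ _≤_ (pow-₊ x) (e∘γ-⋁ x)
    }

open KleeneAlgebraProperties using (⁺-isHKA; ⁺₊-iso)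
open HeterogeneousKleeneAlgebraProperties using (₊-isKA; ₊⁺-iso)
open ContinuousKleeneAlgebraProperties using (⁺-isContinuousHKA)
open ContinuousHeterogeneousKleeneAlgebraProperties using (₊-isContinuousKA)

proposition3p12 : (c ℓ a ℓa s ℓs ι : Level) →
    ((K : RawKA c ℓ) → IsKA K →
       IsHKA (K ⁺) × KAIso K ((K ⁺) ₊))
    × ((H : RawHKA a ℓa s ℓs) → IsHKA H →
       IsKA (H ₊) × HKAIso H ((H ₊) ⁺))
    × ((K : RawKA c ℓ) → IsContinuousKA ι K →
       IsContinuousHKA ι (K ⁺))
    × ((H : RawHKA a ℓa s ℓs) → IsContinuousHKA ι H →
       IsContinuousKA ι (H ₊))
proposition3p12 c ℓ a ℓa s ℓs ι =
  (λ K isKA → ⁺-isHKA K isKA , ⁺₊-iso K isKA) ,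
  (λ H isHKA → ₊-isKA H isHKA , ₊⁺-iso H isHKA) ,
  ⁺-isContinuousHKA {ι = ι} ,
  ₊-isContinuousKA {ι = ι}
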